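{- Let $Q\ge 2$ and $m\ge k\ge 2$ be integers. If $a_1,\ldots,a_m$ are sampled independently and uniformly at random from $\mathbb{Z}_Q$, and $E_k$ is the event that there exist distinct indices $i_1,\ldots,i_k$ with $a_{i_1}+\cdots+a_{i_k}\equiv 0\pmod Q$, then $$1-Q\Big/\binom{m}{k}\ \le\ \Pr[E_k]\ \le\ \binom{m}{k}\Big/Q.$$ -}

module Defs where

open import Data.Bool using (Bool; true; false; if_then_else_)
open import Data.Nat using (ℕ; zero; suc; _^_)
open import Data.Nat.Properties using (_≟_)
open import Data.Nat.Divisibility using (_∣_; _∣?_)
open import Data.Fin using (Fin; toℕ) renaming (zero to fzero; suc to fsuc)
open import Data.Fin.Subset using (Subset; ∣_∣)
open import Data.Fin.Subset.Properties using (anySubset?)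
open import Data.Vec using (Vec; []; _∷_; zipWith; sum)
open import Data.List using (List; []; _∷_; concatMap; map; length; filter)
open import Data.Product using (∃; _×_; _,_)
open import Data.Integer using (+_)
open import Data.Rational using (ℚ; 0ℚ; _/_)
open import Relation.Binary.PropositionalEquality using (_≡_)
open import Relation.Nullary using (Dec)
open import Relation.Nullary.Decidable using (_×-dec_)

sumOver : ∀ {Q m} → Subset m → Vec (Fin Q) m → ℕ
sumOver s a = sum (zipWith (λ b x → if b then toℕ x else 0) s a)

-- The event E_k: there exist k distinct indices (a k-element subset of
-- the index set Fin m) whose entries sum to 0 modulo Q.
E : (Q m k : ℕ) → Vec (Fin Q) m → Set
E Q m k a = ∃ λ (s : Subset m) → (∣ s ∣ ≡ k) × (Q ∣ sumOver s a)

E? : (Q m k : ℕ) → (a : Vec (Fin Q) m) → Dec (E Q m k a)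
E? Q m k a = anySubset? (λ s → (∣ s ∣ ≟ k) ×-dec (Q ∣? sumOver s a))

-- All Q^m outcomes (a_1,…,a_m) ∈ (ℤ_Q)^m, each listed exactly once.
allFins : (Q : ℕ) → List (Fin Q)
allFins zero = []
allFins (suc Q) = fzero ∷ map fsuc (allFins Q)

allVecs : (Q m : ℕ) → List (Vec (Fin Q) m)
allVecs Q zero = [] ∷ []
allVecs Q (suc m) = concatMap (λ x → map (x ∷_) (allVecs Q m)) (allFins Q)

-- Total division of naturals into ℚ (denominator 0 gives 0; never used
-- with denominator 0 under the theorem's hypotheses).
frac : ℕ → ℕ → ℚ
frac n zero = 0ℚ
frac n (suc d) = (+ n) / suc d

PrE : (Q m k : ℕ) → ℚ
PrE Q m k = frac (length (filter (E? Q m k) (allVecs Q m))) (Q ^ m)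

-- For a ∈ ℤ_Q^m let X a be the number of k-subsets of indices on which a sums to 0
-- modulo Q, and N = C(m,k). A sum over a nonempty set of coordinates is uniform modulo Q, and the
-- sums over two distinct nonempty sets are independent, so E X = N/Q and
-- E X² = N/Q + N(N-1)/Q². Markov's inequality gives Pr[E_k] = Pr[X ≥ 1] ≤ N/Q, and
-- Chebyshev's inequality gives Pr[X = 0] ≤ Var X / (E X)² ≤ Q/N. Probabilities are
-- counts over the Q^m outcomes, so everything is proved in ℕ with denominators cleared.
module Submission where

open import Defs
open import Level using (Level)
open import Data.Nat as ℕ using (ℕ; zero; suc; _+_; _*_; _^_; _≤_; _<_; z≤n; s≤s; NonZero)
open import Data.Nat.Properties
open import Data.Nat.Combinatorics using (_C_; nCk+nC[k+1]≡[n+1]C[k+1])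
open import Data.Nat.Divisibility using (_∣_; _∣?_; ∣m+n∣m⇒∣n; ∣m∣n⇒∣m+n; ∣-refl; >⇒∤; _∣0)
open import Data.Nat.Tactic.RingSolver using (solve-∀)
open import Data.Fin using (Fin; toℕ) renaming (suc to fsuc)
open import Data.Fin.Properties using (toℕ<n)
open import Data.Fin.Subset using (Subset; inside; outside; ⊥; ∣_∣; Nonempty)
open import Data.Fin.Subset.Properties using (Empty-unique; nonempty?; ∣⊥∣≡0)
open import Data.Vec using (Vec; []; _∷_; tail; here; there)
import Data.Vec.Properties as Vec
import Data.Bool.Properties as Bool
open import Data.List using (List; []; _∷_; map; _++_; concatMap; length; filter)
open import Data.List.Properties using (length-map)
open import Data.List.Membership.Propositional using () renaming (_∈_ to _∈ₗ_)
import Data.List.Relation.Unary.Any as List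
open import Data.List.Membership.Propositional.Properties using (∈-map⁺; ∈-++⁺ˡ; ∈-++⁺ʳ)
open import Data.Product using (_×_; _,_)
import Data.Integer as ℤ
import Data.Integer.Properties as ℤP
open import Data.Rational as ℚ using (ℚ; 1ℚ; _-_) renaming (_≤_ to _≤ℚ_)
import Data.Rational.Properties as ℚP
open import Data.Rational.Unnormalised using (mkℚᵘ; *≡*; *≤*)
import Data.Rational.Unnormalised.Properties as ℚᵘP
open import Function using (_∘_; _⇔_; mk⇔; Equivalence)
open import Relation.Nullary using (Dec; yes; no; ¬_; ¬?; contradiction)
open import Relation.Nullary.Decidable using (_×-dec_)
open import Relation.Unary using (Pred; Decidable)
open import Relation.Binary.PropositionalEquality

private
  variable
    ℓ ℓ′ : Level
    A B : Set ℓ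

∑ : List A → (A → ℕ) → ℕ
∑ []       f = 0
∑ (x ∷ xs) f = f x + ∑ xs f

∑-cong : ∀ (xs : List A) {f g : A → ℕ} → (∀ x → f x ≡ g x) → ∑ xs f ≡ ∑ xs g
∑-cong []       f≗g = refl
∑-cong (x ∷ xs) f≗g = cong₂ _+_ (f≗g x) (∑-cong xs f≗g)

∑-mono-≤ : ∀ (xs : List A) {f g : A → ℕ} → (∀ x → f x ≤ g x) → ∑ xs f ≤ ∑ xs g
∑-mono-≤ []       f≤g = z≤n
∑-mono-≤ (x ∷ xs) f≤g = +-mono-≤ (f≤g x) (∑-mono-≤ xs f≤g)

∑-distrib-+ : ∀ (xs : List A) (f g : A → ℕ) → ∑ xs (λ x → f x + g x) ≡ ∑ xs f + ∑ xs g
∑-distrib-+ []       f g = refl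
∑-distrib-+ (x ∷ xs) f g = begin
  f x + g x + ∑ xs (λ x → f x + g x) ≡⟨ cong (f x + g x +_) (∑-distrib-+ xs f g) ⟩
  f x + g x + (∑ xs f + ∑ xs g)      ≡⟨ +-interchange (f x) (g x) (∑ xs f) (∑ xs g) ⟩
  f x + ∑ xs f + (g x + ∑ xs g)      ∎
  where
  open ≡-Reasoning
  +-interchange : ∀ a b c d → a + b + (c + d) ≡ a + c + (b + d)
  +-interchange = solve-∀

*-distribˡ-∑ : ∀ (xs : List A) c (f : A → ℕ) → c * ∑ xs f ≡ ∑ xs (λ x → c * f x)
*-distribˡ-∑ []       c f = *-zeroʳ c
*-distribˡ-∑ (x ∷ xs) c f =
  trans (*-distribˡ-+ c (f x) (∑ xs f)) (cong (c * f x +_) (*-distribˡ-∑ xs c f))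

*-distribʳ-∑ : ∀ (xs : List A) c (f : A → ℕ) → ∑ xs f * c ≡ ∑ xs (λ x → f x * c)
*-distribʳ-∑ xs c f = trans (*-comm (∑ xs f) c)
  (trans (*-distribˡ-∑ xs c f) (∑-cong xs (λ x → *-comm c (f x))))

∑-linear : ∀ (xs : List A) c d (f g : A → ℕ) → ∑ xs (λ x → c * f x + d * g x) ≡ c * ∑ xs f + d * ∑ xs g
∑-linear xs c d f g =
  trans (∑-distrib-+ xs _ _) (sym (cong₂ _+_ (*-distribˡ-∑ xs c f) (*-distribˡ-∑ xs d g)))

∑-const : ∀ (xs : List A) c → ∑ xs (λ _ → c) ≡ length xs * c
∑-const []       c = refl
∑-const (x ∷ xs) c = cong (c +_) (∑-const xs c)

∑-zero : ∀ (xs : List A) {f : A → ℕ} → (∀ x → f x ≡ 0) → ∑ xs f ≡ 0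
∑-zero []       f≗0 = refl
∑-zero (x ∷ xs) f≗0 = cong₂ _+_ (f≗0 x) (∑-zero xs f≗0)

∑-constant-multiple : ∀ (xs : List A) {c d} (f : A → ℕ) → (∀ x → c * f x ≡ d) → c * ∑ xs f ≡ length xs * d
∑-constant-multiple xs {c} {d} f cf≡d =
  trans (*-distribˡ-∑ xs c f) (trans (∑-cong xs cf≡d) (∑-const xs d))

∑-++ : ∀ (xs ys : List A) (f : A → ℕ) → ∑ (xs ++ ys) f ≡ ∑ xs f + ∑ ys f
∑-++ []       ys f = refl
∑-++ (x ∷ xs) ys f = trans (cong (f x +_) (∑-++ xs ys f)) (sym (+-assoc (f x) (∑ xs f) (∑ ys f)))

∑-map : ∀ (h : B → A) (xs : List B) (f : A → ℕ) → ∑ (map h xs) f ≡ ∑ xs (f ∘ h)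
∑-map h []       f = refl
∑-map h (x ∷ xs) f = cong (f (h x) +_) (∑-map h xs f)

∑-concatMap : ∀ (h : B → List A) (xs : List B) (f : A → ℕ) → ∑ (concatMap h xs) f ≡ ∑ xs (λ x → ∑ (h x) f)
∑-concatMap h []       f = refl
∑-concatMap h (x ∷ xs) f = trans (∑-++ (h x) (concatMap h xs) f) (cong (∑ (h x) f +_) (∑-concatMap h xs f))

∑-comm : ∀ (xs : List A) (ys : List B) (f : A → B → ℕ) →
         ∑ xs (λ x → ∑ ys (f x)) ≡ ∑ ys (λ y → ∑ xs (λ x → f x y))
∑-comm []       ys f = sym (∑-zero ys (λ _ → refl))
∑-comm (x ∷ xs) ys f = trans (cong (∑ ys (f x) +_) (∑-comm xs ys f)) (sym (∑-distrib-+ ys (f x) _))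

∑-*-∑ : ∀ (xs : List A) (ys : List B) (f : A → ℕ) (g : B → ℕ) →
        ∑ xs f * ∑ ys g ≡ ∑ xs (λ x → ∑ ys (λ y → f x * g y))
∑-*-∑ xs ys f g = trans (*-distribʳ-∑ xs (∑ ys g) f) (∑-cong xs (λ x → *-distribˡ-∑ ys (f x) g))

∈⇒≤∑ : ∀ {xs : List A} {x} (f : A → ℕ) → x ∈ₗ xs → f x ≤ ∑ xs f
∈⇒≤∑ {xs = x ∷ xs} f (List.here refl) = m≤m+n (f x) (∑ xs f)
∈⇒≤∑ {xs = y ∷ xs} f (List.there x∈xs) = ≤-trans (∈⇒≤∑ f x∈xs) (m≤n+m (∑ xs f) (f y))

𝟙 : {P : Set ℓ} → Dec P → ℕ
𝟙 (yes _) = 1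
𝟙 (no _)  = 0

module _ {P : Set ℓ} where

  𝟙-yes : P → (p? : Dec P) → 𝟙 p? ≡ 1
  𝟙-yes p (yes _) = refl
  𝟙-yes p (no ¬p) = contradiction p ¬p

  𝟙-no : ¬ P → (p? : Dec P) → 𝟙 p? ≡ 0
  𝟙-no ¬p (yes p) = contradiction p ¬p
  𝟙-no ¬p (no _)  = refl

  𝟙-idem : (p? : Dec P) → 𝟙 p? * 𝟙 p? ≡ 𝟙 p?
  𝟙-idem (yes _) = refl
  𝟙-idem (no _)  = refl

  𝟙-+-¬? : (p? : Dec P) → 𝟙 p? + 𝟙 (¬? p?) ≡ 1
  𝟙-+-¬? (yes _) = refl
  𝟙-+-¬? (no _)  = refl

  𝟙-*-cong : (p? : Dec P) {m n : ℕ} → (P → m ≡ n) → 𝟙 p? * m ≡ 𝟙 p? * n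
  𝟙-*-cong (yes p) m≡n = cong (_+ 0) (m≡n p)
  𝟙-*-cong (no _)  m≡n = refl

𝟙-cong : {P : Set ℓ} {P′ : Set ℓ′} → P ⇔ P′ → (p? : Dec P) (p′? : Dec P′) → 𝟙 p? ≡ 𝟙 p′?
𝟙-cong P⇔P′ (yes p) p′? = sym (𝟙-yes (Equivalence.to P⇔P′ p) p′?)
𝟙-cong P⇔P′ (no ¬p) p′? = sym (𝟙-no (¬p ∘ Equivalence.from P⇔P′) p′?)

𝟙-×-dec : {P : Set ℓ} {P′ : Set ℓ′} (p? : Dec P) (p′? : Dec P′) → 𝟙 (p? ×-dec p′?) ≡ 𝟙 p? * 𝟙 p′?
𝟙-×-dec (yes _) (yes _) = refl
𝟙-×-dec (yes _) (no _)  = refl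
𝟙-×-dec (no _)  _       = refl

length-filter≡∑𝟙 : ∀ {P : Pred A ℓ} (P? : Decidable P) xs → length (filter P? xs) ≡ ∑ xs (𝟙 ∘ P?)
length-filter≡∑𝟙 P? []       = refl
length-filter≡∑𝟙 P? (x ∷ xs) with P? x
... | yes _ = cong suc (length-filter≡∑𝟙 P? xs)
... | no _  = length-filter≡∑𝟙 P? xs

length-filter-+-¬? : ∀ {P : Pred A ℓ} (P? : Decidable P) xs →
                     length (filter P? xs) + length (filter (¬? ∘ P?) xs) ≡ length xs
length-filter-+-¬? P? xs = begin
  length (filter P? xs) + length (filter (¬? ∘ P?) xs)
    ≡⟨ cong₂ _+_ (length-filter≡∑𝟙 P? xs) (length-filter≡∑𝟙 (¬? ∘ P?) xs) ⟩
  ∑ xs (𝟙 ∘ P?) + ∑ xs (𝟙 ∘ ¬? ∘ P?)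
    ≡⟨ ∑-distrib-+ xs (𝟙 ∘ P?) (𝟙 ∘ ¬? ∘ P?) ⟨
  ∑ xs (λ x → 𝟙 (P? x) + 𝟙 (¬? (P? x)))
    ≡⟨ ∑-cong xs (𝟙-+-¬? ∘ P?) ⟩
  ∑ xs (λ _ → 1)
    ≡⟨ trans (∑-const xs 1) (*-identityʳ (length xs)) ⟩
  length xs ∎
  where open ≡-Reasoning

window : (ℕ → ℕ) → ℕ → ℕ → ℕ
window f n j = ∑ (allFins j) (λ x → f (n + toℕ x))

window-suc : ∀ f n j → window f n (suc j) ≡ f n + window f (suc n) j
window-suc f n j = cong₂ _+_ (cong f (+-identityʳ n))
  (trans (∑-map fsuc (allFins j) _) (∑-cong (allFins j) (λ x → cong f (+-suc n (toℕ x)))))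

window-snoc : ∀ f n j → window f n (suc j) ≡ window f n j + f (n + j)
window-snoc f n zero    = +-comm (f (n + 0)) 0
window-snoc f n (suc j) = begin
  window f n (suc (suc j))                  ≡⟨ window-suc f n (suc j) ⟩
  f n + window f (suc n) (suc j)            ≡⟨ cong (f n +_) (window-snoc f (suc n) j) ⟩
  f n + (window f (suc n) j + f (suc n + j)) ≡⟨ +-assoc (f n) _ _ ⟨
  f n + window f (suc n) j + f (suc n + j)   ≡⟨ cong₂ _+_ (window-suc f n j) (cong f (+-suc n j)) ⟨
  window f n (suc j) + f (n + suc j)         ∎
  where open ≡-Reasoning

window-periodic : ∀ f {p} → (∀ n → f (n + p) ≡ f n) → ∀ n → window f n p ≡ window f 0 p
window-periodic f     per zero    = refl
window-periodic f {p} per (suc n) = trans shift (window-periodic f per n)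
  where
  open ≡-Reasoning
  shift : window f (suc n) p ≡ window f n p
  shift = +-cancelˡ-≡ (f n) _ _ (begin
    f n + window f (suc n) p ≡⟨ window-suc f n p ⟨
    window f n (suc p)       ≡⟨ window-snoc f n p ⟩
    window f n p + f (n + p) ≡⟨ cong (window f n p +_) (per n) ⟩
    window f n p + f n       ≡⟨ +-comm (window f n p) (f n) ⟩
    f n + window f n p       ∎)

∣+self⇔∣ : ∀ d n → (d ∣ n + d) ⇔ (d ∣ n)
∣+self⇔∣ d n = mk⇔ (λ d∣n+d → ∣m+n∣m⇒∣n (subst (d ∣_) (+-comm n d) d∣n+d) ∣-refl)
                   (λ d∣n → ∣m∣n⇒∣m+n d∣n ∣-refl)

window-multiples : ∀ Q .{{_ : NonZero Q}} n → window (λ i → 𝟙 (Q ∣? i)) n Q ≡ 1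
window-multiples Q@(suc q) n = begin
  window f n Q       ≡⟨ window-periodic f (λ i → 𝟙-cong (∣+self⇔∣ Q i) (Q ∣? i + Q) (Q ∣? i)) n ⟩
  window f 0 Q       ≡⟨ window-suc f 0 q ⟩
  f 0 + window f 1 q ≡⟨ cong₂ _+_ (𝟙-yes (Q ∣0) (Q ∣? 0)) (∑-zero (allFins q) below-Q) ⟩
  1                  ∎
  where
  open ≡-Reasoning
  f : ℕ → ℕ
  f i = 𝟙 (Q ∣? i)
  below-Q : ∀ x → f (1 + toℕ x) ≡ 0
  below-Q x = 𝟙-no (>⇒∤ (s≤s (toℕ<n x))) (Q ∣? 1 + toℕ x)

length-allFins : ∀ Q → length (allFins Q) ≡ Q
length-allFins zero    = refl
length-allFins (suc Q) = cong suc (trans (length-map fsuc (allFins Q)) (length-allFins Q))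

∑-allFins-multiple : ∀ Q (f : Fin Q → ℕ) {c d} → (∀ x → c * f x ≡ d) → c * ∑ (allFins Q) f ≡ Q * d
∑-allFins-multiple Q f {c} {d} cf≡d =
  trans (∑-constant-multiple (allFins Q) {c} f cf≡d) (cong (_* d) (length-allFins Q))

∑-allVecs-∷ : ∀ Q m (f : Vec (Fin Q) (suc m) → ℕ) →
              ∑ (allVecs Q (suc m)) f ≡ ∑ (allFins Q) (λ x → ∑ (allVecs Q m) (f ∘ (x ∷_)))
∑-allVecs-∷ Q m f = trans (∑-concatMap (λ x → map (x ∷_) (allVecs Q m)) (allFins Q) f)
                          (∑-cong (allFins Q) (λ x → ∑-map (x ∷_) (allVecs Q m) f))

∑-allVecs-1 : ∀ Q m → ∑ (allVecs Q m) (λ _ → 1) ≡ Q ^ m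
∑-allVecs-1 Q zero    = refl
∑-allVecs-1 Q (suc m) = begin
  ∑ (allVecs Q (suc m)) (λ _ → 1)                 ≡⟨ ∑-allVecs-∷ Q m (λ _ → 1) ⟩
  ∑ (allFins Q) (λ _ → ∑ (allVecs Q m) (λ _ → 1)) ≡⟨ ∑-cong (allFins Q) (λ _ → ∑-allVecs-1 Q m) ⟩
  ∑ (allFins Q) (λ _ → Q ^ m)                     ≡⟨ ∑-const (allFins Q) (Q ^ m) ⟩
  length (allFins Q) * Q ^ m                      ≡⟨ cong (_* Q ^ m) (length-allFins Q) ⟩
  Q * Q ^ m                                       ∎
  where open ≡-Reasoning

length-allVecs : ∀ Q m → length (allVecs Q m) ≡ Q ^ m
length-allVecs Q m = trans (sym (*-identityʳ _)) (trans (sym (∑-const (allVecs Q m) 1)) (∑-allVecs-1 Q m))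

sumOver-⊥ : ∀ {Q m} (a : Vec (Fin Q) m) → sumOver ⊥ a ≡ 0
sumOver-⊥ []      = refl
sumOver-⊥ (x ∷ a) = sumOver-⊥ a

module SubsetSums (Q : ℕ) .{{_ : NonZero Q}} where

  solutions : ∀ {m} → Subset m → ℕ → ℕ
  solutions {m} s r = ∑ (allVecs Q m) (λ a → 𝟙 (Q ∣? r + sumOver s a))

  solutions₂ : ∀ {m} → Subset m → Subset m → ℕ → ℕ → ℕ
  solutions₂ {m} s t r u = ∑ (allVecs Q m) (λ a → 𝟙 (Q ∣? r + sumOver s a) * 𝟙 (Q ∣? u + sumOver t a))

  solutions₂-comm : ∀ {m} (s t : Subset m) r u → solutions₂ s t r u ≡ solutions₂ t s u r
  solutions₂-comm {m} s t r u = ∑-cong (allVecs Q m) (λ a → *-comm (𝟙 (Q ∣? r + sumOver s a)) _)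

  solutions₂-⊥ˡ : ∀ {m} (t : Subset m) r u → solutions₂ ⊥ t r u ≡ 𝟙 (Q ∣? r) * solutions t u
  solutions₂-⊥ˡ {m} t r u = trans
    (∑-cong (allVecs Q m) (λ a → cong (λ n → 𝟙 (Q ∣? n) * 𝟙 (Q ∣? u + sumOver t a))
                                      (trans (cong (r +_) (sumOver-⊥ a)) (+-identityʳ r))))
    (sym (*-distribˡ-∑ (allVecs Q m) (𝟙 (Q ∣? r)) _))

  solutions₂-inside : ∀ {m} (s t : Subset m) r u →
    solutions₂ (inside ∷ s) (inside ∷ t) r u ≡ ∑ (allFins Q) (λ x → solutions₂ s t (r + toℕ x) (u + toℕ x))
  solutions₂-inside {m} s t r u = trans (∑-allVecs-∷ Q m _) (∑-cong (allFins Q) (λ x → ∑-cong (allVecs Q m) (λ a →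
    cong₂ (λ n n′ → 𝟙 (Q ∣? n) * 𝟙 (Q ∣? n′)) (sym (+-assoc r (toℕ x) _)) (sym (+-assoc u (toℕ x) _)))))

  -- Exactly one of the Q values of the first coordinate makes the condition hold.
  ∑-free-coordinate : ∀ {m} (s : Subset m) r (h : Vec (Fin Q) m → ℕ) →
    ∑ (allVecs Q (suc m)) (λ a → 𝟙 (Q ∣? r + sumOver (inside ∷ s) a) * h (tail a)) ≡ ∑ (allVecs Q m) h
  ∑-free-coordinate {m} s r h = begin
    ∑ (allVecs Q (suc m)) (λ a → 𝟙 (Q ∣? r + sumOver (inside ∷ s) a) * h (tail a))
      ≡⟨ ∑-allVecs-∷ Q m _ ⟩
    ∑ (allFins Q) (λ x → ∑ (allVecs Q m) (λ a → hit x a * h a))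
      ≡⟨ ∑-comm (allFins Q) (allVecs Q m) _ ⟩
    ∑ (allVecs Q m) (λ a → ∑ (allFins Q) (λ x → hit x a * h a))
      ≡⟨ ∑-cong (allVecs Q m) (λ a → *-distribʳ-∑ (allFins Q) (h a) (λ x → hit x a)) ⟨
    ∑ (allVecs Q m) (λ a → ∑ (allFins Q) (λ x → hit x a) * h a)
      ≡⟨ ∑-cong (allVecs Q m) (λ a → cong (_* h a) (one-hit a)) ⟩
    ∑ (allVecs Q m) (λ a → 1 * h a)
      ≡⟨ ∑-cong (allVecs Q m) (λ a → *-identityˡ (h a)) ⟩
    ∑ (allVecs Q m) h ∎
    where
    open ≡-Reasoning
    hit : Fin Q → Vec (Fin Q) m → ℕ
    hit x a = 𝟙 (Q ∣? r + (toℕ x + sumOver s a))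
    one-hit : ∀ a → ∑ (allFins Q) (λ x → hit x a) ≡ 1
    one-hit a = trans (∑-cong (allFins Q) (λ x → cong (λ n → 𝟙 (Q ∣? n)) (swap r (toℕ x) (sumOver s a))))
                      (window-multiples Q (r + sumOver s a))
      where
      swap : ∀ r x σ → r + (x + σ) ≡ r + σ + x
      swap = solve-∀

  uniform : ∀ {m} {s : Subset m} → Nonempty s → ∀ r → Q * solutions s r ≡ Q ^ m
  uniform {suc m} {inside ∷ s} _ r = cong (Q *_) (begin
    solutions (inside ∷ s) r
      ≡⟨ ∑-cong (allVecs Q (suc m)) (λ a → *-identityʳ _) ⟨
    ∑ (allVecs Q (suc m)) (λ a → 𝟙 (Q ∣? r + sumOver (inside ∷ s) a) * 1)
      ≡⟨ ∑-free-coordinate s r (λ _ → 1) ⟩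
    ∑ (allVecs Q m) (λ _ → 1)
      ≡⟨ ∑-allVecs-1 Q m ⟩
    Q ^ m ∎)
    where open ≡-Reasoning
  uniform {suc m} {outside ∷ s} (fsuc i , there i∈s) r =
    trans (cong (Q *_) (∑-allVecs-∷ Q m _)) (∑-allFins-multiple Q _ {Q} (λ _ → uniform (i , i∈s) r))

  pairwise-uniform-inside-outside : ∀ {m} (s : Subset m) {t} → Nonempty t → ∀ r u →
                                    Q * Q * solutions₂ (inside ∷ s) (outside ∷ t) r u ≡ Q ^ suc m
  pairwise-uniform-inside-outside {m} s {t} t≢∅ r u = begin
    Q * Q * solutions₂ (inside ∷ s) (outside ∷ t) r u
      ≡⟨ *-assoc Q Q _ ⟩
    Q * (Q * solutions₂ (inside ∷ s) (outside ∷ t) r u)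
      ≡⟨ cong (λ n → Q * (Q * n)) (trans (∑-cong (allVecs Q (suc m)) (λ { (x ∷ a) → refl }))
                                         (∑-free-coordinate s r _)) ⟩
    Q * (Q * solutions t u)
      ≡⟨ cong (Q *_) (uniform t≢∅ u) ⟩
    Q ^ suc m ∎
    where open ≡-Reasoning

  pairwise-uniform-singleton : ∀ {m} {t : Subset m} → Nonempty t → ∀ r u →
                               Q * Q * solutions₂ (inside ∷ ⊥) (inside ∷ t) r u ≡ Q ^ suc m
  pairwise-uniform-singleton {m} {t} t≢∅ r u = begin
    Q * Q * solutions₂ (inside ∷ ⊥) (inside ∷ t) r u
      ≡⟨ cong (Q * Q *_) (trans (solutions₂-inside ⊥ t r u) (∑-cong (allFins Q) (λ x → solutions₂-⊥ˡ t _ _))) ⟩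
    Q * Q * ∑ (allFins Q) (λ x → 𝟙 (Q ∣? r + toℕ x) * solutions t (u + toℕ x))
      ≡⟨ *-distribˡ-∑ (allFins Q) (Q * Q) _ ⟩
    ∑ (allFins Q) (λ x → Q * Q * (𝟙 (Q ∣? r + toℕ x) * solutions t (u + toℕ x)))
      ≡⟨ ∑-cong (allFins Q) term ⟩
    ∑ (allFins Q) (λ x → Q * (𝟙 (Q ∣? r + toℕ x) * Q ^ m))
      ≡⟨ trans (cong (Q *_) (*-distribʳ-∑ (allFins Q) (Q ^ m) _)) (*-distribˡ-∑ (allFins Q) Q _) ⟨
    Q * (window (λ i → 𝟙 (Q ∣? i)) r Q * Q ^ m)
      ≡⟨ cong (λ n → Q * (n * Q ^ m)) (window-multiples Q r) ⟩
    Q * (1 * Q ^ m)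
      ≡⟨ cong (Q *_) (*-identityˡ (Q ^ m)) ⟩
    Q ^ suc m ∎
    where
    open ≡-Reasoning
    rearrange : ∀ q a n → q * q * (a * n) ≡ q * (a * (q * n))
    rearrange = solve-∀
    term : ∀ x → Q * Q * (𝟙 (Q ∣? r + toℕ x) * solutions t (u + toℕ x)) ≡ Q * (𝟙 (Q ∣? r + toℕ x) * Q ^ m)
    term x = trans (rearrange Q (𝟙 (Q ∣? r + toℕ x)) _)
                   (cong (λ n → Q * (𝟙 (Q ∣? r + toℕ x) * n)) (uniform t≢∅ (u + toℕ x)))

  -- Peel off the first coordinate: one lying in exactly one of s and t is free for that
  -- set, one lying in both shifts r and u together.
  pairwise-uniform : ∀ {m} {s t : Subset m} → Nonempty s → Nonempty t → s ≢ t → ∀ r u →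
                     Q * Q * solutions₂ s t r u ≡ Q ^ m
  pairwise-uniform {s = inside ∷ s}  {outside ∷ t} _ (fsuc j , there j∈t) _ r u =
    pairwise-uniform-inside-outside s (j , j∈t) r u
  pairwise-uniform {s = outside ∷ s} {inside ∷ t}  (fsuc i , there i∈s) _ _ r u =
    trans (cong (Q * Q *_) (solutions₂-comm (outside ∷ s) (inside ∷ t) r u))
          (pairwise-uniform-inside-outside t (i , i∈s) u r)
  pairwise-uniform {suc m} {outside ∷ s} {outside ∷ t} (fsuc i , there i∈s) (fsuc j , there j∈t) s≢t r u =
    trans (cong (Q * Q *_) (∑-allVecs-∷ Q m _))
          (∑-allFins-multiple Q _ {Q * Q}
            (λ _ → pairwise-uniform (i , i∈s) (j , j∈t) (s≢t ∘ cong (outside ∷_)) r u))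
  pairwise-uniform {s = inside ∷ s} {inside ∷ t} _ _ s≢t r u with nonempty? s | nonempty? t
  ... | yes s≢∅ | yes t≢∅ =
    trans (cong (Q * Q *_) (solutions₂-inside s t r u))
          (∑-allFins-multiple Q _ {Q * Q} (λ _ → pairwise-uniform s≢∅ t≢∅ (s≢t ∘ cong (inside ∷_)) _ _))
  ... | no s≡∅ | yes t≢∅ rewrite Empty-unique s≡∅ = pairwise-uniform-singleton t≢∅ r u
  ... | yes s≢∅ | no t≡∅ rewrite Empty-unique t≡∅ =
    trans (cong (Q * Q *_) (solutions₂-comm (inside ∷ s) (inside ∷ ⊥) r u))
          (pairwise-uniform-singleton s≢∅ u r)
  ... | no s≡∅ | no t≡∅ =
    contradiction (cong (inside ∷_) (trans (Empty-unique s≡∅) (sym (Empty-unique t≡∅)))) s≢t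

allSubsets : (m : ℕ) → List (Subset m)
allSubsets zero    = [] ∷ []
allSubsets (suc m) = map (outside ∷_) (allSubsets m) ++ map (inside ∷_) (allSubsets m)

∑-allSubsets-∷ : ∀ m (f : Subset (suc m) → ℕ) →
                 ∑ (allSubsets (suc m)) f ≡ ∑ (allSubsets m) (f ∘ (outside ∷_)) + ∑ (allSubsets m) (f ∘ (inside ∷_))
∑-allSubsets-∷ m f = trans (∑-++ (map (outside ∷_) (allSubsets m)) _ f)
  (cong₂ _+_ (∑-map (outside ∷_) (allSubsets m) f) (∑-map (inside ∷_) (allSubsets m) f))

∈-allSubsets : ∀ {m} (s : Subset m) → s ∈ₗ allSubsets m
∈-allSubsets []            = List.here refl
∈-allSubsets (outside ∷ s) = ∈-++⁺ˡ (∈-map⁺ (outside ∷_) (∈-allSubsets s))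
∈-allSubsets (inside ∷ s)  = ∈-++⁺ʳ (map (outside ∷_) (allSubsets _)) (∈-map⁺ (inside ∷_) (∈-allSubsets s))

infix 4 _≟ₛ_
_≟ₛ_ : ∀ {m} (s t : Subset m) → Dec (s ≡ t)
_≟ₛ_ = Vec.≡-dec Bool._≟_

∷-≡⇔ : ∀ {m} x {s t : Subset m} → (x ∷ s ≡ x ∷ t) ⇔ (s ≡ t)
∷-≡⇔ x = mk⇔ Vec.∷-injectiveʳ (cong (x ∷_))

∑-allSubsets-≟ : ∀ {m} (s : Subset m) → ∑ (allSubsets m) (λ t → 𝟙 (s ≟ₛ t)) ≡ 1
∑-allSubsets-≟ []                    = refl
∑-allSubsets-≟ {suc m} (outside ∷ s) = trans (∑-allSubsets-∷ m (λ t → 𝟙 (outside ∷ s ≟ₛ t)))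
  (cong₂ _+_ (trans (∑-cong (allSubsets m) (λ t → 𝟙-cong (∷-≡⇔ outside) (outside ∷ s ≟ₛ outside ∷ t) (s ≟ₛ t)))
                    (∑-allSubsets-≟ s))
             (∑-zero (allSubsets m) (λ t → 𝟙-no (λ ()) (outside ∷ s ≟ₛ inside ∷ t))))
∑-allSubsets-≟ {suc m} (inside ∷ s)  = trans (∑-allSubsets-∷ m (λ t → 𝟙 (inside ∷ s ≟ₛ t)))
  (cong₂ _+_ (∑-zero (allSubsets m) (λ t → 𝟙-no (λ ()) (inside ∷ s ≟ₛ outside ∷ t)))
             (trans (∑-cong (allSubsets m) (λ t → 𝟙-cong (∷-≡⇔ inside) (inside ∷ s ≟ₛ inside ∷ t) (s ≟ₛ t)))
                    (∑-allSubsets-≟ s)))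

∑-allSubsets-δ : ∀ {m} (s : Subset m) (f : Subset m → ℕ) → ∑ (allSubsets m) (λ t → f t * 𝟙 (s ≟ₛ t)) ≡ f s
∑-allSubsets-δ {m} s f = begin
  ∑ (allSubsets m) (λ t → f t * 𝟙 (s ≟ₛ t))
    ≡⟨ ∑-cong (allSubsets m) (λ t → trans (*-comm (f t) _) (𝟙-*-cong (s ≟ₛ t) (λ s≡t → cong f (sym s≡t)))) ⟩
  ∑ (allSubsets m) (λ t → 𝟙 (s ≟ₛ t) * f s)
    ≡⟨ *-distribʳ-∑ (allSubsets m) (f s) _ ⟨
  ∑ (allSubsets m) (λ t → 𝟙 (s ≟ₛ t)) * f s
    ≡⟨ cong (_* f s) (∑-allSubsets-≟ s) ⟩
  1 * f s
    ≡⟨ *-identityˡ (f s) ⟩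
  f s ∎
  where open ≡-Reasoning

∑-allSubsets-size : ∀ m k → ∑ (allSubsets m) (λ s → 𝟙 (∣ s ∣ ≟ k)) ≡ m C k
∑-allSubsets-size zero    zero    = refl
∑-allSubsets-size zero    (suc k) = refl
∑-allSubsets-size (suc m) zero    = trans (∑-allSubsets-∷ m _)
  (cong₂ _+_ (∑-allSubsets-size m zero) (∑-zero (allSubsets m) (λ _ → refl)))
∑-allSubsets-size (suc m) (suc k) = begin
  ∑ (allSubsets (suc m)) (λ s → 𝟙 (∣ s ∣ ≟ suc k))
    ≡⟨ ∑-allSubsets-∷ m _ ⟩
  ∑ (allSubsets m) (λ s → 𝟙 (∣ s ∣ ≟ suc k)) + ∑ (allSubsets m) (λ s → 𝟙 (suc ∣ s ∣ ≟ suc k))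
    ≡⟨ cong (∑ (allSubsets m) (λ s → 𝟙 (∣ s ∣ ≟ suc k)) +_)
            (∑-cong (allSubsets m) (λ s → 𝟙-cong (mk⇔ suc-injective (cong suc)) _ _)) ⟩
  ∑ (allSubsets m) (λ s → 𝟙 (∣ s ∣ ≟ suc k)) + ∑ (allSubsets m) (λ s → 𝟙 (∣ s ∣ ≟ k))
    ≡⟨ cong₂ _+_ (∑-allSubsets-size m (suc k)) (∑-allSubsets-size m k) ⟩
  m C suc k + m C k
    ≡⟨ +-comm (m C suc k) (m C k) ⟩
  m C k + m C suc k
    ≡⟨ nCk+nC[k+1]≡[n+1]C[k+1] m k ⟩
  suc m C suc k ∎
  where open ≡-Reasoning

k≤n⇒0<nCk : ∀ {n k} → k ≤ n → 0 < n C k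
k≤n⇒0<nCk {n}     {zero}  _         = s≤s z≤n
k≤n⇒0<nCk {suc n} {suc k} (s≤s k≤n) =
  subst (0 <_) (nCk+nC[k+1]≡[n+1]C[k+1] n k) (≤-trans (k≤n⇒0<nCk k≤n) (m≤m+n _ _))

2*m*n≤m²+n² : ∀ m n → 2 * (m * n) ≤ m * m + n * n
2*m*n≤m²+n² zero    n       = z≤n
2*m*n≤m²+n² (suc m) zero    = ≤-trans (≤-reflexive (vanishing m)) z≤n
  where
  vanishing : ∀ m → 2 * (suc m * 0) ≡ 0
  vanishing = solve-∀
2*m*n≤m²+n² (suc m) (suc n) = begin
  2 * (suc m * suc n)                   ≡⟨ expand m n ⟩
  2 * (m * n) + (2 + 2 * m + 2 * n)     ≤⟨ +-monoˡ-≤ (2 + 2 * m + 2 * n) (2*m*n≤m²+n² m n) ⟩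
  m * m + n * n + (2 + 2 * m + 2 * n)   ≡⟨ collect m n ⟩
  suc m * suc m + suc n * suc n         ∎
  where
  open ≤-Reasoning
  expand : ∀ m n → 2 * (suc m * suc n) ≡ 2 * (m * n) + (2 + 2 * m + 2 * n)
  expand = solve-∀
  collect : ∀ m n → m * m + n * n + (2 + 2 * m + 2 * n) ≡ suc m * suc m + suc n * suc n
  collect = solve-∀

-- Chebyshev's inequality  c² · #{x ∈ xs | P x} ≤ ∑ (Y x − c)²  for Y vanishing on P,
-- with the square expanded so that no subtraction occurs.
chebyshev : ∀ (xs : List A) (Y : A → ℕ) {P : Pred A ℓ} (P? : Decidable P) → (∀ x → P x → Y x ≡ 0) → ∀ c →
            ∑ xs (𝟙 ∘ P?) * (c * c) + 2 * (c * ∑ xs Y) ≤ ∑ xs (λ x → Y x * Y x) + length xs * (c * c)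
chebyshev xs Y P? P⇒Y≡0 c = begin
  ∑ xs (𝟙 ∘ P?) * (c * c) + 2 * (c * ∑ xs Y)
    ≡⟨ cong₂ _+_ (*-distribʳ-∑ xs (c * c) (𝟙 ∘ P?))
                 (trans (cong (2 *_) (*-distribˡ-∑ xs c Y)) (*-distribˡ-∑ xs 2 (λ x → c * Y x))) ⟩
  ∑ xs (λ x → 𝟙 (P? x) * (c * c)) + ∑ xs (λ x → 2 * (c * Y x))
    ≡⟨ ∑-distrib-+ xs _ _ ⟨
  ∑ xs (λ x → 𝟙 (P? x) * (c * c) + 2 * (c * Y x))
    ≤⟨ ∑-mono-≤ xs pointwise ⟩
  ∑ xs (λ x → Y x * Y x + c * c)
    ≡⟨ trans (∑-distrib-+ xs _ _) (cong (∑ xs (λ x → Y x * Y x) +_) (∑-const xs (c * c))) ⟩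
  ∑ xs (λ x → Y x * Y x) + length xs * (c * c) ∎
  where
  open ≤-Reasoning
  pointwise : ∀ x → 𝟙 (P? x) * (c * c) + 2 * (c * Y x) ≤ Y x * Y x + c * c
  pointwise x with P? x
  ... | yes Px rewrite P⇒Y≡0 x Px = ≤-reflexive (vanishing c)
    where
    vanishing : ∀ c → 1 * (c * c) + 2 * (c * 0) ≡ 0 * 0 + c * c
    vanishing = solve-∀
  ... | no _ = subst (2 * (c * Y x) ≤_) (+-comm (c * c) (Y x * Y x)) (2*m*n≤m²+n² c (Y x))

second-moment-arith : ∀ {z n p q s} → 0 < n →
                      z * (n * n) + 2 * (n * (n * p)) ≤ s + p * (n * n) →
                      s + p * n ≡ p * n * n + q * p * n →
                      z * n ≤ q * p
second-moment-arith {z} {n} {p} {q} {s} 0<n bound moment =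
  m+n≤o⇒m≤o (z * n) (*-cancelˡ-≤ n {{ℕ.>-nonZero 0<n}} (+-cancelʳ-≤ (2 * (n * (n * p))) _ _ (begin
    n * (z * n + p) + 2 * (n * (n * p))     ≡⟨ e₁ z n p ⟩
    z * (n * n) + 2 * (n * (n * p)) + p * n ≤⟨ +-monoˡ-≤ (p * n) bound ⟩
    s + p * (n * n) + p * n                 ≡⟨ e₂ s p n ⟩
    s + p * n + p * (n * n)                 ≡⟨ cong (_+ p * (n * n)) moment ⟩
    p * n * n + q * p * n + p * (n * n)     ≡⟨ e₃ p n q ⟩
    n * (q * p) + 2 * (n * (n * p))         ∎)))
  where
  open ≤-Reasoning
  e₁ : ∀ z n p → n * (z * n + p) + 2 * (n * (n * p)) ≡ z * (n * n) + 2 * (n * (n * p)) + p * n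
  e₁ = solve-∀
  e₂ : ∀ s p n → s + p * (n * n) + p * n ≡ s + p * n + p * (n * n)
  e₂ = solve-∀
  e₃ : ∀ p n q → p * n * n + q * p * n + p * (n * n) ≡ n * (q * p) + 2 * (n * (n * p))
  e₃ = solve-∀

frac-≤ : ∀ {a b c d} → 0 < b → 0 < d → a * d ≤ c * b → frac a b ≤ℚ frac c d
frac-≤ {a} {suc b} {c} {suc d} _ _ ad≤cb = ℚP.toℚᵘ-cancel-≤
  (ℚᵘP.≤-respˡ-≃ (ℚᵘP.≃-sym (ℚP.toℚᵘ-fromℚᵘ (mkℚᵘ (ℤ.+ a) b)))
  (ℚᵘP.≤-respʳ-≃ (ℚᵘP.≃-sym (ℚP.toℚᵘ-fromℚᵘ (mkℚᵘ (ℤ.+ c) d)))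
  (*≤* (subst₂ ℤ._≤_ (ℤP.pos-* a (suc d)) (ℤP.pos-* c (suc b)) (ℤ.+≤+ ad≤cb)))))

frac-+ : ∀ {a b n} → 0 < n → a + b ≡ n → frac a n ℚ.+ frac b n ≡ 1ℚ
frac-+ {a} {b} {suc n} _ a+b≡n = ℚP.toℚᵘ-injective
  (ℚᵘP.≃-trans (ℚP.toℚᵘ-homo-+ (frac a (suc n)) (frac b (suc n)))
  (ℚᵘP.≃-trans (ℚᵘP.+-cong (ℚP.toℚᵘ-fromℚᵘ (mkℚᵘ a′ n)) (ℚP.toℚᵘ-fromℚᵘ (mkℚᵘ b′ n)))
  (*≡* cross)))
  where
  open ≡-Reasoning
  a′ b′ n′ : ℤ.ℤ
  a′ = ℤ.+ a
  b′ = ℤ.+ b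
  n′ = ℤ.+ suc n
  cross : (a′ ℤ.* n′ ℤ.+ b′ ℤ.* n′) ℤ.* ℤ.1ℤ ≡ ℤ.1ℤ ℤ.* (n′ ℤ.* n′)
  cross = begin
    (a′ ℤ.* n′ ℤ.+ b′ ℤ.* n′) ℤ.* ℤ.1ℤ ≡⟨ ℤP.*-identityʳ _ ⟩
    a′ ℤ.* n′ ℤ.+ b′ ℤ.* n′            ≡⟨ ℤP.*-distribʳ-+ n′ a′ b′ ⟨
    (a′ ℤ.+ b′) ℤ.* n′                ≡⟨ cong (λ x → ℤ.+ x ℤ.* n′) a+b≡n ⟩
    n′ ℤ.* n′                        ≡⟨ ℤP.*-identityˡ _ ⟨
    ℤ.1ℤ ℤ.* (n′ ℤ.* n′)             ∎

frac-complement : ∀ {a b n} → 0 < n → a + b ≡ n → 1ℚ - frac b n ≡ frac a n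
frac-complement {a} {b} {n} 0<n a+b≡n = begin
  1ℚ - y           ≡⟨ cong (_- y) (frac-+ 0<n a+b≡n) ⟨
  (x ℚ.+ y) - y    ≡⟨ ℚP.+-assoc x y (ℚ.- y) ⟩
  x ℚ.+ (y - y)    ≡⟨ cong (x ℚ.+_) (ℚP.+-inverseʳ y) ⟩
  x ℚ.+ ℚ.0ℚ       ≡⟨ ℚP.+-identityʳ x ⟩
  x                ∎
  where
  open ≡-Reasoning
  x y : ℚ
  x = frac a n
  y = frac b n

module ZeroSumSubsets (Q : ℕ) .{{_ : NonZero Q}} (m k : ℕ) (0<k : 0 < k) where

  open SubsetSums Q

  isZeroSum? : (a : Vec (Fin Q) m) (s : Subset m) → Dec ((∣ s ∣ ≡ k) × (Q ∣ sumOver s a))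
  isZeroSum? a s = (∣ s ∣ ≟ k) ×-dec (Q ∣? sumOver s a)

  zeroSums : Vec (Fin Q) m → ℕ
  zeroSums a = ∑ (allSubsets m) (𝟙 ∘ isZeroSum? a)

  𝟙ₖ : Subset m → ℕ
  𝟙ₖ s = 𝟙 (∣ s ∣ ≟ k)

  private
    V = allVecs Q m
    S = allSubsets m
    N = m C k
    P = Q ^ m

  ∣s∣≡k⇒Nonempty : ∀ {s : Subset m} → ∣ s ∣ ≡ k → Nonempty s
  ∣s∣≡k⇒Nonempty {s} ∣s∣≡k with nonempty? s
  ... | yes s≢∅ = s≢∅
  ... | no s≡∅  = contradiction (trans (sym ∣s∣≡k) (trans (cong ∣_∣ (Empty-unique s≡∅)) (∣⊥∣≡0 m)))
                                (≢-sym (<⇒≢ 0<k))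

  E⇒1≤zeroSums : ∀ a → E Q m k a → 1 ≤ zeroSums a
  E⇒1≤zeroSums a (s , ∣s∣≡k , Q∣σ) =
    ≤-trans (≤-reflexive (sym (𝟙-yes (∣s∣≡k , Q∣σ) (isZeroSum? a s)))) (∈⇒≤∑ (𝟙 ∘ isZeroSum? a) (∈-allSubsets s))

  ¬E⇒zeroSums≡0 : ∀ a → ¬ E Q m k a → zeroSums a ≡ 0
  ¬E⇒zeroSums≡0 a ¬Ea = ∑-zero S (λ s → 𝟙-no (λ (∣s∣≡k , Q∣σ) → ¬Ea (s , ∣s∣≡k , Q∣σ)) (isZeroSum? a s))

  first-moment : Q * ∑ V zeroSums ≡ N * P
  first-moment = begin
    Q * ∑ V zeroSums
      ≡⟨ cong (Q *_) (∑-comm V S _) ⟩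
    Q * ∑ S (λ s → ∑ V (λ a → 𝟙 (isZeroSum? a s)))
      ≡⟨ cong (Q *_) (∑-cong S weighted) ⟩
    Q * ∑ S (λ s → 𝟙ₖ s * solutions s 0)
      ≡⟨ *-distribˡ-∑ S Q _ ⟩
    ∑ S (λ s → Q * (𝟙ₖ s * solutions s 0))
      ≡⟨ ∑-cong S weighted-uniform ⟩
    ∑ S (λ s → 𝟙ₖ s * P)
      ≡⟨ *-distribʳ-∑ S P 𝟙ₖ ⟨
    ∑ S 𝟙ₖ * P
      ≡⟨ cong (_* P) (∑-allSubsets-size m k) ⟩
    N * P ∎
    where
    open ≡-Reasoning
    *-left-comm : ∀ x y z → x * (y * z) ≡ y * (x * z)
    *-left-comm = solve-∀
    weighted : ∀ s → ∑ V (λ a → 𝟙 (isZeroSum? a s)) ≡ 𝟙ₖ s * solutions s 0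
    weighted s = trans (∑-cong V (λ a → 𝟙-×-dec (∣ s ∣ ≟ k) (Q ∣? sumOver s a))) (sym (*-distribˡ-∑ V (𝟙ₖ s) _))
    weighted-uniform : ∀ s → Q * (𝟙ₖ s * solutions s 0) ≡ 𝟙ₖ s * P
    weighted-uniform s = trans (*-left-comm Q (𝟙ₖ s) _)
      (𝟙-*-cong (∣ s ∣ ≟ k) (λ ∣s∣≡k → uniform (∣s∣≡k⇒Nonempty {s} ∣s∣≡k) 0))

  jointSolutions : Subset m → ℕ
  jointSolutions s = ∑ S (λ t → 𝟙ₖ t * solutions₂ s t 0 0)

  ∑-zeroSums² : ∑ V (λ a → zeroSums a * zeroSums a) ≡ ∑ S (λ s → 𝟙ₖ s * jointSolutions s)
  ∑-zeroSums² = begin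
    ∑ V (λ a → zeroSums a * zeroSums a)
      ≡⟨ ∑-cong V (λ a → ∑-*-∑ S S (𝟙 ∘ isZeroSum? a) (𝟙 ∘ isZeroSum? a)) ⟩
    ∑ V (λ a → ∑ S (λ s → ∑ S (λ t → 𝟙 (isZeroSum? a s) * 𝟙 (isZeroSum? a t))))
      ≡⟨ ∑-comm V S _ ⟩
    ∑ S (λ s → ∑ V (λ a → ∑ S (λ t → 𝟙 (isZeroSum? a s) * 𝟙 (isZeroSum? a t))))
      ≡⟨ ∑-cong S (λ s → ∑-comm V S _) ⟩
    ∑ S (λ s → ∑ S (λ t → ∑ V (λ a → 𝟙 (isZeroSum? a s) * 𝟙 (isZeroSum? a t))))
      ≡⟨ ∑-cong S (λ s → trans (∑-cong S (pair s)) (sym (*-distribˡ-∑ S (𝟙ₖ s) _))) ⟩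
    ∑ S (λ s → 𝟙ₖ s * jointSolutions s) ∎
    where
    open ≡-Reasoning
    interchange : ∀ a b c d → a * b * (c * d) ≡ a * (c * (b * d))
    interchange = solve-∀
    pair : ∀ s t → ∑ V (λ a → 𝟙 (isZeroSum? a s) * 𝟙 (isZeroSum? a t)) ≡ 𝟙ₖ s * (𝟙ₖ t * solutions₂ s t 0 0)
    pair s t = begin
      ∑ V (λ a → 𝟙 (isZeroSum? a s) * 𝟙 (isZeroSum? a t))
        ≡⟨ ∑-cong V (λ a → trans (cong₂ _*_ (𝟙-×-dec (∣ s ∣ ≟ k) (Q ∣? sumOver s a))
                                             (𝟙-×-dec (∣ t ∣ ≟ k) (Q ∣? sumOver t a)))
                                 (interchange (𝟙ₖ s) _ (𝟙ₖ t) _)) ⟩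
      ∑ V (λ a → 𝟙ₖ s * (𝟙ₖ t * (𝟙 (Q ∣? sumOver s a) * 𝟙 (Q ∣? sumOver t a))))
        ≡⟨ *-distribˡ-∑ V (𝟙ₖ s) _ ⟨
      𝟙ₖ s * ∑ V (λ a → 𝟙ₖ t * (𝟙 (Q ∣? sumOver s a) * 𝟙 (Q ∣? sumOver t a)))
        ≡⟨ cong (𝟙ₖ s *_) (*-distribˡ-∑ V (𝟙ₖ t) _) ⟨
      𝟙ₖ s * (𝟙ₖ t * solutions₂ s t 0 0) ∎

  -- The diagonal case s = t and the independent case s ≠ t, packed into one identity
  -- without subtraction.
  solutions₂-k-subsets : ∀ {s t} → ∣ s ∣ ≡ k → ∣ t ∣ ≡ k →
                         Q * Q * solutions₂ s t 0 0 + P * 𝟙 (s ≟ₛ t) ≡ P + Q * P * 𝟙 (s ≟ₛ t)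
  solutions₂-k-subsets {s} {t} ∣s∣≡k ∣t∣≡k with s ≟ₛ t
  ... | yes refl = trans (cong (_+ P * 1) QQsol≡QP) (swap (Q * P) P)
    where
    swap : ∀ x p → x + p * 1 ≡ p + x * 1
    swap = solve-∀
    QQsol≡QP : Q * Q * solutions₂ s s 0 0 ≡ Q * P
    QQsol≡QP = trans (*-assoc Q Q _) (cong (Q *_) (trans
      (cong (Q *_) (∑-cong V (λ a → 𝟙-idem (Q ∣? sumOver s a)))) (uniform (∣s∣≡k⇒Nonempty {s} ∣s∣≡k) 0)))
  ... | no s≢t = trans
    (cong (_+ P * 0) (pairwise-uniform (∣s∣≡k⇒Nonempty ∣s∣≡k) (∣s∣≡k⇒Nonempty ∣t∣≡k) s≢t 0 0))
    (annihilate P (Q * P))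
    where
    annihilate : ∀ p x → p + p * 0 ≡ p + x * 0
    annihilate = solve-∀

  jointSolutions-k-subset : ∀ {s} → ∣ s ∣ ≡ k → Q * Q * jointSolutions s + P ≡ P * N + Q * P
  jointSolutions-k-subset {s} ∣s∣≡k = begin
    Q * Q * jointSolutions s + P
      ≡⟨ cong (Q * Q * jointSolutions s +_) (*-identityʳ P) ⟨
    Q * Q * jointSolutions s + P * 1
      ≡⟨ cong (λ n → Q * Q * jointSolutions s + P * n) diagonal ⟨
    Q * Q * jointSolutions s + P * ∑ S (λ t → 𝟙ₖ t * 𝟙 (s ≟ₛ t))
      ≡⟨ ∑-linear S (Q * Q) P _ _ ⟨
    ∑ S (λ t → Q * Q * (𝟙ₖ t * solutions₂ s t 0 0) + P * (𝟙ₖ t * 𝟙 (s ≟ₛ t)))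
      ≡⟨ ∑-cong S pointwise ⟩
    ∑ S (λ t → P * 𝟙ₖ t + Q * P * (𝟙ₖ t * 𝟙 (s ≟ₛ t)))
      ≡⟨ ∑-linear S P (Q * P) _ _ ⟩
    P * ∑ S 𝟙ₖ + Q * P * ∑ S (λ t → 𝟙ₖ t * 𝟙 (s ≟ₛ t))
      ≡⟨ cong₂ (λ n n′ → P * n + Q * P * n′) (∑-allSubsets-size m k) diagonal ⟩
    P * N + Q * P * 1
      ≡⟨ cong (P * N +_) (*-identityʳ (Q * P)) ⟩
    P * N + Q * P ∎
    where
    open ≡-Reasoning
    diagonal : ∑ S (λ t → 𝟙ₖ t * 𝟙 (s ≟ₛ t)) ≡ 1
    diagonal = trans (∑-allSubsets-δ s 𝟙ₖ) (𝟙-yes ∣s∣≡k (∣ s ∣ ≟ k))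
    factor : ∀ q p w x y → q * q * (w * x) + p * (w * y) ≡ w * (q * q * x + p * y)
    factor = solve-∀
    unfactor : ∀ q p w y → w * (p + q * p * y) ≡ p * w + q * p * (w * y)
    unfactor = solve-∀
    pointwise : ∀ t → Q * Q * (𝟙ₖ t * solutions₂ s t 0 0) + P * (𝟙ₖ t * 𝟙 (s ≟ₛ t))
                    ≡ P * 𝟙ₖ t + Q * P * (𝟙ₖ t * 𝟙 (s ≟ₛ t))
    pointwise t = trans (factor Q P (𝟙ₖ t) _ _)
      (trans (𝟙-*-cong (∣ t ∣ ≟ k) (solutions₂-k-subsets ∣s∣≡k)) (unfactor Q P (𝟙ₖ t) _))

  second-moment : Q * Q * ∑ V (λ a → zeroSums a * zeroSums a) + P * N ≡ P * N * N + Q * P * N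
  second-moment = begin
    Q * Q * ∑ V (λ a → zeroSums a * zeroSums a) + P * N
      ≡⟨ cong₂ (λ x y → Q * Q * x + P * y) ∑-zeroSums² (sym (∑-allSubsets-size m k)) ⟩
    Q * Q * ∑ S (λ s → 𝟙ₖ s * jointSolutions s) + P * ∑ S 𝟙ₖ
      ≡⟨ ∑-linear S (Q * Q) P _ _ ⟨
    ∑ S (λ s → Q * Q * (𝟙ₖ s * jointSolutions s) + P * 𝟙ₖ s)
      ≡⟨ ∑-cong S pointwise ⟩
    ∑ S (λ s → P * N * 𝟙ₖ s + Q * P * 𝟙ₖ s)
      ≡⟨ ∑-linear S (P * N) (Q * P) 𝟙ₖ 𝟙ₖ ⟩
    P * N * ∑ S 𝟙ₖ + Q * P * ∑ S 𝟙ₖ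
      ≡⟨ cong (λ n → P * N * n + Q * P * n) (∑-allSubsets-size m k) ⟩
    P * N * N + Q * P * N ∎
    where
    open ≡-Reasoning
    factor : ∀ q p w x → q * q * (w * x) + p * w ≡ w * (q * q * x + p)
    factor = solve-∀
    unfactor : ∀ q p n w → w * (p * n + q * p) ≡ p * n * w + q * p * w
    unfactor = solve-∀
    pointwise : ∀ s → Q * Q * (𝟙ₖ s * jointSolutions s) + P * 𝟙ₖ s ≡ P * N * 𝟙ₖ s + Q * P * 𝟙ₖ s
    pointwise s = trans (factor Q P (𝟙ₖ s) _)
      (trans (𝟙-*-cong (∣ s ∣ ≟ k) (jointSolutions-k-subset {s})) (unfactor Q P N (𝟙ₖ s)))

  #E #¬E : ℕ
  #E  = length (filter (E? Q m k) V)
  #¬E = length (filter (¬? ∘ E? Q m k) V)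

  markov : #E * Q ≤ N * P
  markov = begin
    #E * Q                 ≡⟨ *-comm #E Q ⟩
    Q * #E                 ≡⟨ cong (Q *_) (length-filter≡∑𝟙 (E? Q m k) V) ⟩
    Q * ∑ V (𝟙 ∘ E? Q m k) ≤⟨ *-monoʳ-≤ Q (∑-mono-≤ V 𝟙E≤zeroSums) ⟩
    Q * ∑ V zeroSums       ≡⟨ first-moment ⟩
    N * P                  ∎
    where
    open ≤-Reasoning
    𝟙E≤zeroSums : ∀ a → 𝟙 (E? Q m k a) ≤ zeroSums a
    𝟙E≤zeroSums a with E? Q m k a
    ... | yes Ea = E⇒1≤zeroSums a Ea
    ... | no _   = z≤n

  second-moment-method : 0 < N → #¬E * N ≤ Q * P
  second-moment-method 0<N =
    second-moment-arith {#¬E} {N} {P} {Q} {Q * Q * ∑ V (λ a → zeroSums a * zeroSums a)}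
                        0<N chebyshev-bound second-moment
    where
    open ≤-Reasoning
    vanishes : ∀ a → ¬ E Q m k a → Q * zeroSums a ≡ 0
    vanishes a ¬Ea = trans (cong (Q *_) (¬E⇒zeroSums≡0 a ¬Ea)) (*-zeroʳ Q)
    rearrange : ∀ q x → q * x * (q * x) ≡ q * q * (x * x)
    rearrange = solve-∀
    squares : ∑ V (λ a → Q * zeroSums a * (Q * zeroSums a)) ≡ Q * Q * ∑ V (λ a → zeroSums a * zeroSums a)
    squares = trans (∑-cong V (λ a → rearrange Q (zeroSums a))) (sym (*-distribˡ-∑ V (Q * Q) _))
    chebyshev-bound : #¬E * (N * N) + 2 * (N * (N * P))
                    ≤ Q * Q * ∑ V (λ a → zeroSums a * zeroSums a) + P * (N * N)
    chebyshev-bound = begin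
      #¬E * (N * N) + 2 * (N * (N * P))
        ≡⟨ cong₂ (λ c x → c * (N * N) + 2 * (N * x)) (length-filter≡∑𝟙 (¬? ∘ E? Q m k) V)
                 (trans (sym first-moment) (*-distribˡ-∑ V Q zeroSums)) ⟩
      ∑ V (𝟙 ∘ ¬? ∘ E? Q m k) * (N * N) + 2 * (N * ∑ V (λ a → Q * zeroSums a))
        ≤⟨ chebyshev V (λ a → Q * zeroSums a) (¬? ∘ E? Q m k) vanishes N ⟩
      ∑ V (λ a → Q * zeroSums a * (Q * zeroSums a)) + length V * (N * N)
        ≡⟨ cong₂ _+_ squares (cong (_* (N * N)) (length-allVecs Q m)) ⟩
      Q * Q * ∑ V (λ a → zeroSums a * zeroSums a) + P * (N * N) ∎

lemma3p3 : (Q m k : ℕ) → 2 ≤ Q → 2 ≤ k → k ≤ m →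
    ((1ℚ - frac Q (m C k)) ≤ℚ PrE Q m k) × (PrE Q m k ≤ℚ frac (m C k) Q)
lemma3p3 Q@(suc _) m k _ 2≤k k≤m = lower , upper
  where
  open ZeroSumSubsets Q m k (≤-trans (s≤s z≤n) 2≤k)
  0<P : 0 < Q ^ m
  0<P = m^n>0 Q m
  0<N : 0 < m C k
  0<N = k≤n⇒0<nCk k≤m
  upper : PrE Q m k ≤ℚ frac (m C k) Q
  upper = frac-≤ {#E} {Q ^ m} {m C k} {Q} 0<P (s≤s z≤n) markov
  #E+#¬E≡Q^m : #E + #¬E ≡ Q ^ m
  #E+#¬E≡Q^m = trans (length-filter-+-¬? (E? Q m k) (allVecs Q m)) (length-allVecs Q m)
  lower : 1ℚ - frac Q (m C k) ≤ℚ PrE Q m k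
  lower = begin
    1ℚ - frac Q (m C k)   ≤⟨ ℚP.+-monoʳ-≤ 1ℚ (ℚP.neg-antimono-≤ (frac-≤ 0<P 0<N (second-moment-method 0<N))) ⟩
    1ℚ - frac #¬E (Q ^ m) ≡⟨ frac-complement 0<P #E+#¬E≡Q^m ⟩
    PrE Q m k             ∎
    where open ℚP.≤-Reasoning
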